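{- Let $k$ and $n$ be positive integers. If the hypercube $Q_k$ divides the hypercube $Q_n$, then $k$ divides $n$.
   Context: $Q_n$ is the $n$-dimensional hypercube: vertex set the subsets of $\{1,\ldots,n\}$, with $x,y$ adjacent iff $|x\,\Delta\, y|=1$. If $H$ is isomorphic to a subgraph of $G$, $H$ divides $G$ if there exist embeddings $\theta_1,\ldots,\theta_r$ of $H$ into $G$ such that $\{E(\theta_1(H)),\ldots,E(\theta_r(H))\}$ is a partition of $E(G)$. -}

module Defs where

open import Data.Nat using (ℕ)
open import Data.Bool using (Bool)
open import Data.Fin using (Fin)
open import Data.Vec using (Vec; lookup)
open import Data.Product using (Σ; _×_; ∃-syntax)
open import Relation.Binary.PropositionalEquality using (_≡_; _≢_)
open import Function.Definitions using (Injective)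

-- Vertices of the hypercube Q n: subsets of {1,…,n}, encoded by their
-- characteristic vectors.
Vertex : ℕ → Set
Vertex n = Vec Bool n

Adj : (n : ℕ) → Vertex n → Vertex n → Set
Adj n x y = Σ (Fin n) λ i → (lookup x i ≢ lookup y i) × (∀ j → j ≢ i → lookup x j ≡ lookup y j)

-- An embedding of Q k into Q n: an injective vertex map sending edges to edges
-- (i.e. an isomorphism of Q k onto a (not necessarily induced) subgraph of Q n).
record Embedding (k n : ℕ) : Set where
  field
    map       : Vertex k → Vertex n
    injective : Injective _≡_ _≡_ map
    preserves : ∀ u v → Adj k u v → Adj n (map u) (map v)
open Embedding public

-- The edge {x,y} of Q n belongs to the edge set E(θ(Q k)).
-- (Adjacency is symmetric, so ordered pairs suffice.)
EdgeIn : {k n : ℕ} → Embedding k n → Vertex n → Vertex n → Set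
EdgeIn {k} θ x y = Σ (Vertex k) λ u → Σ (Vertex k) λ v →
  Adj k u v × (map θ u ≡ x) × (map θ v ≡ y)

-- Q k divides Q n: there are embeddings θ₁,…,θᵣ whose edge sets partition E(Q n):
-- every edge of Q n lies in the edge set of exactly one θᵢ.
-- (Each θᵢ(Q k) has edges whenever k ≥ 1, so all blocks are nonempty.)
Divides : ℕ → ℕ → Set
Divides k n = Σ ℕ λ r → Σ (Fin r → Embedding k n) λ θ →
  ∀ x y → Adj n x y →
    (∃[ i ] EdgeIn (θ i) x y) ×
    (∀ i j → EdgeIn (θ i) x y → EdgeIn (θ j) x y → i ≡ j)

module Submission where

-- Proof idea: a vertex degree count at one vertex x of Q n.  The n edges of
-- Q n at x run in the n coordinate directions; colour direction j by the
-- unique block θᵢ of the partition containing the edge x — flip x j.  If a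
-- block θᵢ contains some edge at x, then x = θᵢ(u) for a (unique) vertex u
-- of Q k, and the edges of θᵢ(Q k) at x are exactly the images of the k
-- edges of Q k at u, which run in k distinct directions.  So every colour
-- class has size 0 or k, and n, the sum of their sizes, is divisible by k.

open import Defs
open import Data.Nat using (ℕ; zero; suc; _+_; _≤_)
open import Data.Nat.Divisibility using (_∣_; _∣0; ∣-refl; ∣m∣n⇒∣m+n)
open import Data.Nat.Properties using (+-0-commutativeMonoid)
open import Data.Bool using (false; not; if_then_else_)
open import Data.Bool.Properties using (not-¬; ¬-not)
open import Data.Fin using (Fin; zero; suc; _≟_; punchIn)
open import Data.Fin.Properties using (punchInᵢ≢i)
open import Data.Vec using (lookup; replicate; _[_]%=_)
open import Data.Vec.Properties using (lookup∘updateAt; lookup∘updateAt′)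
open import Data.Vec.Relation.Binary.Pointwise.Extensional using (ext; Pointwise-≡⇒≡)
open import Data.Vec.Functional using (Vector; tail)
open import Data.List using (List; []; _∷_; filter; length; allFin) renaming (map to mapList)
open import Data.List.Properties using (length-map; length-tabulate)
open import Data.List.Membership.Propositional using (_∈_)
open import Data.List.Membership.Propositional.Properties
  using (∈-filter⁻; ∈-filter⁺; ∈-map⁻; ∈-map⁺; ∈-allFin)
open import Data.List.Membership.Propositional.Properties.WithK using (unique∧set⇒bag)
open import Data.List.Relation.Binary.BagAndSetEquality using (_∼[_]_; bag; ∼bag⇒↭)
open import Data.List.Relation.Binary.Permutation.Propositional.Properties using (↭-length)
open import Data.List.Relation.Unary.Any using (here)
open import Data.List.Relation.Unary.Unique.Propositional using (Unique)
import Data.List.Relation.Unary.Unique.Propositional.Properties as Unique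
open import Data.Product using (Σ; _×_; _,_; proj₁; proj₂; ∃-syntax)
open import Function using (_∘_)
open import Function.Bundles using (mk⇔)
open import Function.Definitions using (Injective)
open import Relation.Nullary using (does; yes; no; contradiction)
open import Relation.Binary.PropositionalEquality
  using (_≡_; _≢_; refl; sym; trans; cong; cong₂; subst; module ≡-Reasoning)
open import Algebra.Properties.CommutativeMonoid.Sum +-0-commutativeMonoid
  using (sum; sum-remove; sum-cong-≗; sum-replicate-zero; ∑-distrib-+)

open ≡-Reasoning

flip : {n : ℕ} → Vertex n → Fin n → Vertex n
flip x i = x [ i ]%= not

flip-adjacent : {n : ℕ} (x : Vertex n) (i : Fin n) → Adj n x (flip x i)
flip-adjacent x i =
  i , (λ e → not-¬ refl (trans e (lookup∘updateAt i x)))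
    , (λ j j≢i → sym (lookup∘updateAt′ j i j≢i x))

adjacent⇒flip : {n : ℕ} (x y : Vertex n) (a : Adj n x y) → y ≡ flip x (proj₁ a)
adjacent⇒flip x y (i , xᵢ≢yᵢ , same) = Pointwise-≡⇒≡ (ext coordinate)
  where
  coordinate : ∀ j → lookup y j ≡ lookup (flip x i) j
  coordinate j with j ≟ i
  ... | yes refl = trans (¬-not (xᵢ≢yᵢ ∘ sym)) (sym (lookup∘updateAt i x))
  ... | no j≢i = trans (sym (same j j≢i)) (sym (lookup∘updateAt′ j i j≢i x))

flip-injective : {n : ℕ} (x : Vertex n) → Injective _≡_ _≡_ (flip x)
flip-injective x {i} {j} e with i ≟ j
... | yes i≡j = i≡j
... | no i≢j = contradiction (sym flipped) (not-¬ refl)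
  where
  flipped : not (lookup x i) ≡ lookup x i
  flipped = begin
    not (lookup x i)       ≡⟨ lookup∘updateAt i x ⟨
    lookup (flip x i) i    ≡⟨ cong (λ w → lookup w i) e ⟩
    lookup (flip x j) i    ≡⟨ lookup∘updateAt′ i j i≢j x ⟩
    lookup x i             ∎

module Star {k n : ℕ} (θ : Embedding k n) (u : Vertex k) where

  edge-image : (l : Fin k) → Adj n (map θ u) (map θ (flip u l))
  edge-image l = preserves θ u (flip u l) (flip-adjacent u l)

  direction : Fin k → Fin n
  direction l = proj₁ (edge-image l)

  map-flip : ∀ l → map θ (flip u l) ≡ flip (map θ u) (direction l)
  map-flip l = adjacent⇒flip _ _ (edge-image l)

  direction-injective : Injective _≡_ _≡_ direction
  direction-injective {l} {l′} e = flip-injective u (injective θ (begin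
    map θ (flip u l)                ≡⟨ map-flip l ⟩
    flip (map θ u) (direction l)    ≡⟨ cong (flip (map θ u)) e ⟩
    flip (map θ u) (direction l′)   ≡⟨ map-flip l′ ⟨
    map θ (flip u l′)               ∎))

  star-sound : ∀ {x} → map θ u ≡ x → ∀ l → EdgeIn θ x (flip x (direction l))
  star-sound refl l = u , flip u l , flip-adjacent u l , refl , map-flip l

  -- … and every edge of θ(Q k) at x = θ u runs in a direction of the star;
  -- this needs injectivity of θ, since the edge may start at any preimage of x.
  star-complete : ∀ {x} → map θ u ≡ x → ∀ j → EdgeIn θ x (flip x j) →
                  Σ (Fin k) λ l → direction l ≡ j
  star-complete refl j (u′ , v , a , θu′≡θu , θv≡flip) with injective θ θu′≡θu
  ... | refl = proj₁ a , flip-injective (map θ u) (begin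
    flip (map θ u) (direction (proj₁ a))  ≡⟨ map-flip (proj₁ a) ⟨
    map θ (flip u (proj₁ a))              ≡⟨ cong (map θ) (adjacent⇒flip u v a) ⟨
    map θ v                               ≡⟨ θv≡flip ⟩
    flip (map θ u) j                      ∎)

fibre : {A : Set} {r : ℕ} → (A → Fin r) → Fin r → List A → List A
fibre f i = filter (λ a → f a ≟ i)

indicator : {r : ℕ} → Fin r → Fin r → ℕ
indicator a i = if does (a ≟ i) then 1 else 0

indicator-self : {r : ℕ} (a : Fin r) → indicator a a ≡ 1
indicator-self a with a ≟ a
... | yes _ = refl
... | no a≢a = contradiction refl a≢a

indicator-other : {r : ℕ} {a i : Fin r} → a ≢ i → indicator a i ≡ 0
indicator-other {a = a} {i} a≢i with a ≟ i
... | yes a≡i = contradiction a≡i a≢i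
... | no _ = refl

sum-indicator : {r : ℕ} (a : Fin r) → sum (indicator a) ≡ 1
sum-indicator {suc r} a = begin
  sum (indicator a)                                   ≡⟨ sum-remove {i = a} (indicator a) ⟩
  indicator a a + sum (indicator a ∘ punchIn a)       ≡⟨ cong₂ _+_ (indicator-self a) rest-zero ⟩
  1                                                   ∎
  where
  rest-zero : sum (indicator a ∘ punchIn a) ≡ 0
  rest-zero = trans (sum-cong-≗ (λ j → indicator-other (punchInᵢ≢i a j ∘ sym)))
                    (sum-replicate-zero r)

fibre-cons : {A : Set} {r : ℕ} (f : A → Fin r) (i : Fin r) (x : A) (xs : List A) →
             length (fibre f i (x ∷ xs)) ≡ indicator (f x) i + length (fibre f i xs)
fibre-cons f i x xs with f x ≟ i
... | yes _ = refl
... | no _ = refl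

length≡sum-fibres : {A : Set} {r : ℕ} (f : A → Fin r) (xs : List A) →
                    length xs ≡ sum (λ i → length (fibre f i xs))
length≡sum-fibres {r = r} f [] = sym (sum-replicate-zero r)
length≡sum-fibres {r = r} f (x ∷ xs) = sym (begin
  sum (λ i → length (fibre f i (x ∷ xs)))                ≡⟨ sum-cong-≗ (λ i → fibre-cons f i x xs) ⟩
  sum (λ i → indicator (f x) i + length (fibre f i xs))  ≡⟨ ∑-distrib-+ (indicator (f x)) _ ⟩
  sum (indicator (f x)) + sum (λ i → length (fibre f i xs))
    ≡⟨ cong₂ _+_ (sum-indicator (f x)) (sym (length≡sum-fibres f xs)) ⟩
  suc (length xs)                                        ∎)

∣-sum : {k r : ℕ} (t : Vector ℕ r) → (∀ i → k ∣ t i) → k ∣ sum t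
∣-sum {k} {zero} t k∣t = k ∣0
∣-sum {k} {suc r} t k∣t = ∣m∣n⇒∣m+n (k∣t zero) (∣-sum (tail t) (k∣t ∘ suc))

∣-if-fibres-∣ : {k n r : ℕ} (f : Fin n → Fin r) →
               (∀ i → k ∣ length (fibre f i (allFin n))) → k ∣ n
∣-if-fibres-∣ {k} {n} f k∣fibre = subst (k ∣_) length-allFin (∣-sum _ k∣fibre)
  where
  length-allFin : sum (λ i → length (fibre f i (allFin n))) ≡ n
  length-allFin = trans (sym (length≡sum-fibres f (allFin n))) (length-tabulate (λ j → j))

-- A duplicate-free list whose members are exactly the values of an
-- injection g : Fin k → A has length k (it is a permutation of the image).
length-image : {A : Set} {k : ℕ} {xs : List A} (g : Fin k → A) → Injective _≡_ _≡_ g →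
               Unique xs → (∀ l → g l ∈ xs) → (∀ {a} → a ∈ xs → Σ (Fin k) λ l → g l ≡ a) →
               length xs ≡ k
length-image {k = k} {xs} g g-injective xs-unique image⊆xs xs⊆image = begin
  length xs                       ≡⟨ ↭-length (∼bag⇒↭ xs∼image) ⟩
  length (mapList g (allFin k))   ≡⟨ length-map g (allFin k) ⟩
  length (allFin k)               ≡⟨ length-tabulate (λ l → l) ⟩
  k                               ∎
  where
  to : ∀ {a} → a ∈ xs → a ∈ mapList g (allFin k)
  to a∈xs with xs⊆image a∈xs
  ... | l , refl = ∈-map⁺ g (∈-allFin l)

  from : ∀ {a} → a ∈ mapList g (allFin k) → a ∈ xs
  from a∈image with ∈-map⁻ g a∈image
  ... | l , _ , refl = image⊆xs l

  xs∼image : xs ∼[ bag ] mapList g (allFin k)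
  xs∼image = unique∧set⇒bag xs-unique (Unique.map⁺ g-injective (Unique.allFin⁺ k)) (mk⇔ to from)

-- A list all of whose members certify that it has length k (in particular
-- the empty list) has length divisible by k.
∣-length : {A : Set} {k : ℕ} (xs : List A) → (∀ {a} → a ∈ xs → length xs ≡ k) → k ∣ length xs
∣-length {k = k} []       _          = k ∣0
∣-length {k = k} (a ∷ xs) length≡k = subst (k ∣_) (sym (length≡k (here refl))) ∣-refl

module DegreeCount {k n r : ℕ} (θ : Fin r → Embedding k n)
  (partition : ∀ x y → Adj n x y →
     (∃[ i ] EdgeIn (θ i) x y) × (∀ i j → EdgeIn (θ i) x y → EdgeIn (θ j) x y → i ≡ j))
  (x : Vertex n) where

  block : Fin n → Fin r
  block j = proj₁ (proj₁ (partition x (flip x j) (flip-adjacent x j)))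

  block-contains : ∀ j → EdgeIn (θ (block j)) x (flip x j)
  block-contains j = proj₂ (proj₁ (partition x (flip x j) (flip-adjacent x j)))

  block-unique : ∀ j i → EdgeIn (θ i) x (flip x j) → block j ≡ i
  block-unique j i = proj₂ (partition x (flip x j) (flip-adjacent x j)) (block j) i (block-contains j)

  colour-class : Fin r → List (Fin n)
  colour-class i = fibre block i (allFin n)

  in-class : ∀ {i j} → j ∈ colour-class i → block j ≡ i
  in-class {i} = proj₂ ∘ ∈-filter⁻ (λ j → block j ≟ i) {xs = allFin n}

  -- A non-empty colour class is the star of block i at the preimage of x,
  -- hence has exactly k elements.
  class-size : ∀ i j → block j ≡ i → length (colour-class i) ≡ k
  class-size i j refl with block-contains j
  ... | u , _ , _ , θu≡x , _ =
    length-image direction direction-injective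
      (Unique.filter⁺ (λ j → block j ≟ i) (Unique.allFin⁺ n))
      (λ l → ∈-filter⁺ (λ j → block j ≟ i) (∈-allFin (direction l))
               (block-unique (direction l) i (star-sound θu≡x l)))
      (λ {j′} j′∈class → star-complete θu≡x j′
               (subst (λ i′ → EdgeIn (θ i′) x (flip x j′)) (in-class j′∈class) (block-contains j′)))
    where open Star (θ i) u

  class-size-∣ : ∀ i → k ∣ length (colour-class i)
  class-size-∣ i = ∣-length (colour-class i) (λ j∈class → class-size i _ (in-class j∈class))

corollary2 : (k n : ℕ) → 1 ≤ k → 1 ≤ n → Divides k n → k ∣ n
corollary2 k n _ _ (r , θ , partition) = ∣-if-fibres-∣ block class-size-∣
  where open DegreeCount θ partition (replicate n false)
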